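{- Let $\ell$ be a prime with $\ell\ge5$, let $p(t)=t^4+36t^2+432$ and $r_\ell:=\#\{t\in\mathbb{F}_\ell: p(t)=0\}$. Put $\Delta=-432$ and let $\left(\frac{\cdot}{\ell}\right)$ be the Legendre symbol. Then \[r_\ell=\begin{cases}0,&\text{if }\left(\frac{\Delta}{\ell}\right)=-1,\\ 2+\left(\frac{u_1}{\ell}\right)+\left(\frac{u_2}{\ell}\right),&\text{if }\left(\frac{\Delta}{\ell}\right)=1,\end{cases}\] where $u_1,u_2\in\mathbb{F}_\ell$ are the roots of $u^2+36u+432=0$. In particular: if $\left(\frac{\Delta}{\ell}\right)=-1$ then $r_\ell=0$; if $\left(\frac{\Delta}{\ell}\right)=1$ and $\left(\frac{432}{\ell}\right)=-1$ then $r_\ell=2$; if $\left(\frac{\Delta}{\ell}\right)=1$ and $\left(\frac{432}{\ell}\right)=1$ then $r_\ell\in\{0,4\}$. Equivalently, when $\Delta$ is a square in $\mathbb{F}_\ell$ with square root $\sqrt{\Delta}$, \[r_\ell=2+\left(\frac{(-36+\sqrt\Delta)/2}{\ell}\right)+\left(\frac{(-36-\sqrt\Delta)/2}{\ell}\right),\] and this is independent of the choice of sign of $\sqrt\Delta$. -}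

module Defs where

open import Data.Nat as ℕ using (ℕ; NonZero)
open import Data.Nat.Properties using (_≟_)
open import Data.Integer as ℤ using (ℤ; +_; -[1+_]; _*_)
open import Data.Integer.DivMod using (_%ℕ_)
open import Data.List using (List; length; filter; upTo)
open import Data.List.Relation.Unary.Any using (any?)
open import Relation.Binary.PropositionalEquality using (_≡_)
open import Relation.Nullary using (yes; no)

congMod : (ℓ : ℕ) → .{{NonZero ℓ}} → ℤ → ℤ → Set
congMod ℓ a b = a %ℕ ℓ ≡ b %ℕ ℓ

p : ℤ → ℤ
p t = t * t * t * t ℤ.+ ℤ.+ 36 * t * t ℤ.+ ℤ.+ 432

rootCount : (ℓ : ℕ) → .{{NonZero ℓ}} → ℕ
rootCount ℓ = length (filter (λ t → p (+ t) %ℕ ℓ ≟ 0) (upTo ℓ))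

legendre : ℤ → (ℓ : ℕ) → .{{NonZero ℓ}} → ℤ
legendre a ℓ with a %ℕ ℓ ≟ 0
... | yes _ = + 0
... | no _ with any? (λ x → (+ x * + x) %ℕ ℓ ≟ a %ℕ ℓ) (upTo ℓ)
...   | yes _ = + 1
...   | no _ = -[1+ 0 ]

-- Modulo ℓ we have p(t) = q(t²) with q(u) = u² + 36u + 432, whose discriminant is Δ = -432,
-- and 4p(t) = (2t² + 36)² - Δ. So if Δ is not a square, p has no roots. If it is, q has the
-- two distinct roots u = (-36 ± √Δ)/2, p(t) = (t² - u₁)(t² - u₂), and r_ℓ = N(u₁) + N(u₂),
-- where N(c) = #{t : t² = c} equals 1 + (c/ℓ) for c ≠ 0. The special cases follow from
-- u₁u₂ = 432 and the multiplicativity of the Legendre symbol. Its only non-trivial part, that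
-- a product of two non-squares a, b is a square, is a double count: Σ_c N(c) = Σ_c N(ac) = ℓ,
-- while N(c) + N(ac) ≤ 2 for every c; hence N(c) + N(ac) = 2 everywhere, and at c = b this
-- gives N(ab) = 2.
module Submission where

open import Data.Nat as ℕ using (ℕ; zero; suc; NonZero; _≥_)
import Data.Nat.Properties as ℕ
import Data.Nat.Divisibility as ℕ
open import Data.Nat.Primality using (Prime; euclidsLemma; prime⇒irreducible)
open import Data.Nat.Coprimality using (Coprime; coprime-Bézout)
open import Data.Nat.GCD using (module Bézout)
open import Data.Integer as ℤ using (ℤ; +_; -[1+_]; _*_; -_; 0ℤ; 1ℤ; -1ℤ; _%ℕ_; _/ℕ_; ∣_∣; _⊖_)
import Data.Integer.Properties as ℤ
open import Data.Integer.DivMod using (n%ℕd<d; a≡a%ℕn+[a/ℕn]*n)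
open import Data.Integer.Divisibility.Signed
  using (_∣_; divides; _∣?_; ∣m∣n⇒∣m+n; ∣m⇒∣-m; ∣n⇒∣m*n; ∣m⇒∣m*n; ∣⇒∣ᵤ; ∣ᵤ⇒∣)
open import Data.Integer.Tactic.RingSolver using (solve; solve-∀)
open import Data.Fin as Fin using (Fin; toℕ; fromℕ<)
import Data.Fin.Properties as Fin
open import Data.Fin.Properties using (_≟_)
open import Data.List using (_∷_; []; length; filter; applyUpTo; upTo)
open import Data.List.Relation.Unary.Any using (Any; any?)
open import Data.List.Relation.Unary.Any.Properties using (applyUpTo⁺; applyUpTo⁻)
open import Data.Product using (∃; _,_; _×_; map₂)
open import Data.Sum as Sum using (_⊎_; inj₁; inj₂; [_,_]′)
open import Function using (_∘_; id; flip; case_of_; _⇔_; mk⇔; Equivalence)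
open import Relation.Binary using (Setoid; IsEquivalence)
import Relation.Binary.Reasoning.Setoid as SetoidReasoning
open import Relation.Binary.PropositionalEquality as ≡
  using (_≡_; _≢_; refl; subst; cong; cong₂)
open import Relation.Nullary using (¬_; Dec; yes; no; _⊎-dec_; contradiction)
open import Relation.Nullary.Decidable using (map′; decidable-stable)
open import Relation.Unary using (Pred; Decidable)
open import Algebra.Properties.Semiring.Sum ℕ.+-*-semiring
  using (sum-syntax; sum-cong-≗; ∑-distrib-+; ∑-comm)
open import Algebra.Properties.CommutativeSemigroup ℤ.*-commutativeSemigroup using (interchange)

open import Defs

module Counting where

  open import Data.Nat using (_+_; _≤_)

  𝟙 : ∀ {p} {P : Set p} → Dec P → ℕ
  𝟙 (yes _) = 1
  𝟙 (no _)  = 0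

  𝟙-cong : ∀ {p q} {P : Set p} {Q : Set q} → P ⇔ Q → (P? : Dec P) (Q? : Dec Q) → 𝟙 P? ≡ 𝟙 Q?
  𝟙-cong P⇔Q (yes _) (yes _) = refl
  𝟙-cong P⇔Q (no _)  (no _)  = refl
  𝟙-cong P⇔Q (yes p) (no ¬q) = contradiction (Equivalence.to P⇔Q p) ¬q
  𝟙-cong P⇔Q (no ¬p) (yes q) = contradiction (Equivalence.from P⇔Q q) ¬p

  𝟙-⊎ : ∀ {p q} {P : Set p} {Q : Set q} → ¬ (P × Q) → (P? : Dec P) (Q? : Dec Q) →
        𝟙 (P? ⊎-dec Q?) ≡ 𝟙 P? + 𝟙 Q?
  𝟙-⊎ ¬P×Q (yes p) (yes q) = contradiction (p , q) ¬P×Q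
  𝟙-⊎ ¬P×Q (yes _) (no _)  = refl
  𝟙-⊎ ¬P×Q (no _)  (yes _) = refl
  𝟙-⊎ ¬P×Q (no _)  (no _)  = refl

  length-filter-applyUpTo : ∀ {p} {A : Set} {P : Pred A p} (P? : Decidable P) (f : ℕ → A) n →
                            length (filter P? (applyUpTo f n)) ≡ ∑[ i < n ] 𝟙 (P? (f (toℕ i)))
  length-filter-applyUpTo P? f zero = refl
  length-filter-applyUpTo P? f (suc n) with P? (f 0)
  ... | yes _ = cong suc (length-filter-applyUpTo P? (f ∘ suc) n)
  ... | no _  = length-filter-applyUpTo P? (f ∘ suc) n

  count : ∀ {n p} {P : Pred (Fin n) p} → Decidable P → ℕ
  count {n} P? = ∑[ i < n ] 𝟙 (P? i)

  module _ {n p q} {P : Pred (Fin n) p} {Q : Pred (Fin n) q} (P? : Decidable P) (Q? : Decidable Q) where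

    count-cong : (∀ i → P i ⇔ Q i) → count P? ≡ count Q?
    count-cong P⇔Q = sum-cong-≗ (λ i → 𝟙-cong (P⇔Q i) (P? i) (Q? i))

    count-⊎ : (∀ i → ¬ (P i × Q i)) → count (λ i → P? i ⊎-dec Q? i) ≡ count P? + count Q?
    count-⊎ disjoint =
      ≡.trans (sum-cong-≗ (λ i → 𝟙-⊎ (disjoint i) (P? i) (Q? i))) (∑-distrib-+ (𝟙 ∘ P?) (𝟙 ∘ Q?))

  count-∅ : ∀ {n p} {P : Pred (Fin n) p} (P? : Decidable P) → (∀ i → ¬ P i) → count P? ≡ 0
  count-∅ {zero}  P? ∅ = refl
  count-∅ {suc n} P? ∅ with P? Fin.zero
  ... | yes p = contradiction p (∅ Fin.zero)
  ... | no _  = count-∅ (P? ∘ Fin.suc) (∅ ∘ Fin.suc)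

  count-≡ : ∀ {n} (j : Fin n) → count (_≟ j) ≡ 1
  count-≡ {suc n} Fin.zero    = cong suc (count-∅ {n} (λ i → Fin.suc i ≟ Fin.zero) (λ i ()))
  count-≡ {suc n} (Fin.suc j) = ≡.trans
    (count-cong {n} (λ i → Fin.suc i ≟ Fin.suc j) (_≟ j) (λ i → mk⇔ Fin.suc-injective (cong Fin.suc)))
    (count-≡ j)

  count-unique : ∀ {n p} {P : Pred (Fin n) p} (P? : Decidable P) (j : Fin n) →
                 (∀ i → P i ⇔ i ≡ j) → count P? ≡ 1
  count-unique P? j P⇔≡j = ≡.trans (count-cong P? (_≟ j) P⇔≡j) (count-≡ j)

  ∑-1 : ∀ n → ∑[ i < n ] 1 ≡ n
  ∑-1 zero    = refl
  ∑-1 (suc n) = cong suc (∑-1 n)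

  ∑-mono-≤ : ∀ {n} {f g : Fin n → ℕ} → (∀ i → f i ≤ g i) → ∑[ i < n ] f i ≤ ∑[ i < n ] g i
  ∑-mono-≤ {zero}  f≤g = ℕ.z≤n
  ∑-mono-≤ {suc n} f≤g = ℕ.+-mono-≤ (f≤g Fin.zero) (∑-mono-≤ (f≤g ∘ Fin.suc))

  +-≤-rigid : ∀ {a b c d} → a ≤ b → c ≤ d → a + c ≡ b + d → a ≡ b × c ≡ d
  +-≤-rigid {a} {b} {c} {d} a≤b c≤d a+c≡b+d =
      ℕ.≤-antisym a≤b (ℕ.+-cancelʳ-≤ d b a b+d≤a+d)
    , ℕ.≤-antisym c≤d (ℕ.+-cancelˡ-≤ b d c b+d≤b+c)
    where
    b+d≤a+d : b + d ≤ a + d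
    b+d≤a+d = subst (_≤ a + d) a+c≡b+d (ℕ.+-monoʳ-≤ a c≤d)
    b+d≤b+c : b + d ≤ b + c
    b+d≤b+c = subst (_≤ b + c) a+c≡b+d (ℕ.+-monoˡ-≤ c a≤b)

  pointwise-≤∧∑-≡⇒≡ : ∀ {n} {f g : Fin n → ℕ} → (∀ i → f i ≤ g i) →
                      ∑[ i < n ] f i ≡ ∑[ i < n ] g i → ∀ i → f i ≡ g i
  pointwise-≤∧∑-≡⇒≡ {suc n} f≤g ∑f≡∑g i
    with +-≤-rigid (f≤g Fin.zero) (∑-mono-≤ (f≤g ∘ Fin.suc)) ∑f≡∑g
  pointwise-≤∧∑-≡⇒≡ {suc n} f≤g ∑f≡∑g Fin.zero    | f₀≡g₀ , _     = f₀≡g₀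
  pointwise-≤∧∑-≡⇒≡ {suc n} f≤g ∑f≡∑g (Fin.suc i) | _     , ∑f≡∑g′ =
    pointwise-≤∧∑-≡⇒≡ (f≤g ∘ Fin.suc) ∑f≡∑g′ i

open Counting

module Congruence (ℓ : ℕ) .{{_ : NonZero ℓ}} where

  open import Data.Integer using (_+_; _-_)

  infix 4 _≈_ _≈?_

  -- A record rather than a type synonym, so that a and b can be inferred from a ≈ b.
  record _≈_ (a b : ℤ) : Set where
    constructor mk≈
    field ℓ∣a-b : + ℓ ∣ a - b

  _≈?_ : ∀ a b → Dec (a ≈ b)
  a ≈? b = map′ mk≈ _≈_.ℓ∣a-b (+ ℓ ∣? a - b)

  ∣⇒≈ : ∀ {a b x} → + ℓ ∣ x → x ≡ a - b → a ≈ b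
  ∣⇒≈ ℓ∣x refl = mk≈ ℓ∣x

  ≈⇒∣ : ∀ {a b x} → a ≈ b → a - b ≡ x → + ℓ ∣ x
  ≈⇒∣ (mk≈ ℓ∣a-b) refl = ℓ∣a-b

  ≈-reflexive : ∀ {a b} → a ≡ b → a ≈ b
  ≈-reflexive {a} refl = mk≈ (divides 0ℤ (ℤ.+-inverseʳ a))

  ≈-refl : ∀ {a} → a ≈ a
  ≈-refl = ≈-reflexive refl

  ≈-sym : ∀ {a b} → a ≈ b → b ≈ a
  ≈-sym {a} {b} (mk≈ ℓ∣a-b) = ∣⇒≈ (∣m⇒∣-m ℓ∣a-b) (solve (a ∷ b ∷ []))

  ≈-trans : ∀ {a b c} → a ≈ b → b ≈ c → a ≈ c
  ≈-trans {a} {b} {c} (mk≈ ℓ∣a-b) (mk≈ ℓ∣b-c) = ∣⇒≈ (∣m∣n⇒∣m+n ℓ∣a-b ℓ∣b-c) (solve (a ∷ b ∷ c ∷ []))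

  ≈-isEquivalence : IsEquivalence _≈_
  ≈-isEquivalence = record { refl = ≈-refl ; sym = ≈-sym ; trans = ≈-trans }

  ≈-setoid : Setoid _ _
  ≈-setoid = record { isEquivalence = ≈-isEquivalence }

  module ≈-Reasoning = SetoidReasoning ≈-setoid

  +-cong : ∀ {a b c d} → a ≈ b → c ≈ d → a + c ≈ b + d
  +-cong {a} {b} {c} {d} (mk≈ ℓ∣a-b) (mk≈ ℓ∣c-d) =
    ∣⇒≈ (∣m∣n⇒∣m+n ℓ∣a-b ℓ∣c-d) (solve (a ∷ b ∷ c ∷ d ∷ []))

  -‿cong : ∀ {a b} → a ≈ b → - a ≈ - b
  -‿cong {a} {b} (mk≈ ℓ∣a-b) = ∣⇒≈ (∣m⇒∣-m ℓ∣a-b) (solve (a ∷ b ∷ []))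

  *-cong : ∀ {a b c d} → a ≈ b → c ≈ d → a * c ≈ b * d
  *-cong {a} {b} {c} {d} (mk≈ ℓ∣a-b) (mk≈ ℓ∣c-d) =
    ∣⇒≈ (∣m∣n⇒∣m+n (∣m⇒∣m*n c ℓ∣a-b) (∣n⇒∣m*n b ℓ∣c-d)) (solve (a ∷ b ∷ c ∷ d ∷ []))

  +-congˡ : ∀ a {b c} → b ≈ c → a + b ≈ a + c
  +-congˡ a = +-cong (≈-refl {a})

  +-congʳ : ∀ c {a b} → a ≈ b → a + c ≈ b + c
  +-congʳ c a≈b = +-cong a≈b (≈-refl {c})

  *-congˡ : ∀ a {b c} → b ≈ c → a * b ≈ a * c
  *-congˡ a = *-cong (≈-refl {a})

  *-congʳ : ∀ c {a b} → a ≈ b → a * c ≈ b * c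
  *-congʳ c a≈b = *-cong a≈b (≈-refl {c})

  ≈0⇔∣ : ∀ {a} → a ≈ 0ℤ ⇔ + ℓ ∣ a
  ≈0⇔∣ {a} = mk⇔ (λ a≈0 → ≈⇒∣ a≈0 (ℤ.+-identityʳ a)) (λ ℓ∣a → ∣⇒≈ ℓ∣a (≡.sym (ℤ.+-identityʳ a)))

  ≈⇒difference≈0 : ∀ {a b e} → a ≈ b → a - b ≡ e → e ≈ 0ℤ
  ≈⇒difference≈0 a≈b a-b≡e = Equivalence.from ≈0⇔∣ (≈⇒∣ a≈b a-b≡e)

  a-b≈0⇒a≈b : ∀ {a b} → a - b ≈ 0ℤ → a ≈ b
  a-b≈0⇒a≈b a-b≈0 = mk≈ (≈⇒∣ a-b≈0 (ℤ.+-identityʳ _))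

  ≡+*ℓ⇒≈ : ∀ {a b} k → a ≡ b + k * + ℓ → a ≈ b
  ≡+*ℓ⇒≈ {a} {b} k a≡b+kℓ = ∣⇒≈ (divides k refl) (begin
    k * + ℓ             ≡⟨ +-sub-cancel b (k * + ℓ) ⟨
    (b + k * + ℓ) - b   ≡⟨ cong (_- b) a≡b+kℓ ⟨
    a - b               ∎)
    where
    open ≡.≡-Reasoning
    +-sub-cancel : ∀ x y → (x + y) - x ≡ y
    +-sub-cancel = solve-∀

  ≈-%ℕ : ∀ a → a ≈ + (a %ℕ ℓ)
  ≈-%ℕ a = ≡+*ℓ⇒≈ (a /ℕ ℓ) (a≡a%ℕn+[a/ℕn]*n a ℓ)

  +-≈-injective : ∀ {m n} → m ℕ.< ℓ → n ℕ.< ℓ → + m ≈ + n → m ≡ n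
  +-≈-injective {m} {n} m<ℓ n<ℓ (mk≈ ℓ∣m-n) = ℤ.+-injective (ℤ.i-j≡0⇒i≡j (+ m) (+ n)
    (≡.trans (ℤ.m-n≡m⊖n m n) (ℤ.∣i∣≡0⇒i≡0 (ℓ∣k<ℓ⇒k≡0 ℓ∣∣m⊖n∣ ∣m⊖n∣<ℓ))))
    where
    ℓ∣k<ℓ⇒k≡0 : ∀ {k} → ℓ ℕ.∣ k → k ℕ.< ℓ → k ≡ 0
    ℓ∣k<ℓ⇒k≡0 {zero}  _   _   = refl
    ℓ∣k<ℓ⇒k≡0 {suc k} ℓ∣k k<ℓ = contradiction (ℕ.∣⇒≤ ℓ∣k) (ℕ.<⇒≱ k<ℓ)
    ∣m⊖n∣<ℓ : ∣ m ⊖ n ∣ ℕ.< ℓ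
    ∣m⊖n∣<ℓ = ℕ.≤-<-trans (ℤ.∣m⊝n∣≤m⊔n m n) (ℕ.⊔-lub m<ℓ n<ℓ)
    ℓ∣∣m⊖n∣ : ℓ ℕ.∣ ∣ m ⊖ n ∣
    ℓ∣∣m⊖n∣ = subst (λ x → ℓ ℕ.∣ ∣ x ∣) (ℤ.m-n≡m⊖n m n) (∣⇒∣ᵤ ℓ∣m-n)

  congMod⇔≈ : ∀ a b → congMod ℓ a b ⇔ a ≈ b
  congMod⇔≈ a b = mk⇔
    (λ a%ℓ≡b%ℓ → ≈-trans (≈-%ℕ a) (subst (λ r → + r ≈ b) (≡.sym a%ℓ≡b%ℓ) (≈-sym (≈-%ℕ b))))
    (λ a≈b → +-≈-injective (n%ℕd<d a ℓ) (n%ℕd<d b ℓ) (≈-trans (≈-sym (≈-%ℕ a)) (≈-trans a≈b (≈-%ℕ b))))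

  %ℕ≡0⇔≈0 : ∀ {a} → a %ℕ ℓ ≡ 0 ⇔ a ≈ 0ℤ
  %ℕ≡0⇔≈0 {a} = mk⇔
    (λ a%ℓ≡0 → subst (λ r → a ≈ + r) a%ℓ≡0 (≈-%ℕ a))
    (λ a≈0 → +-≈-injective (n%ℕd<d a ℓ) (ℕ.>-nonZero⁻¹ ℓ) (≈-trans (≈-sym (≈-%ℕ a)) a≈0))

  toℤ : Fin ℓ → ℤ
  toℤ i = + toℕ i

  residue : ℤ → Fin ℓ
  residue a = fromℕ< (n%ℕd<d a ℓ)

  toℤ-residue : ∀ a → toℤ (residue a) ≈ a
  toℤ-residue a = subst (λ r → + r ≈ a) (≡.sym (Fin.toℕ-fromℕ< (n%ℕd<d a ℓ))) (≈-sym (≈-%ℕ a))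

  toℤ-≈-injective : ∀ {i j} → toℤ i ≈ toℤ j → i ≡ j
  toℤ-≈-injective {i} {j} i≈j = Fin.toℕ-injective (+-≈-injective (Fin.toℕ<n i) (Fin.toℕ<n j) i≈j)

  toℤ≈⇔≡residue : ∀ {i} a → toℤ i ≈ a ⇔ i ≡ residue a
  toℤ≈⇔≡residue a = mk⇔
    (λ i≈a → toℤ-≈-injective (≈-trans i≈a (≈-sym (toℤ-residue a))))
    (λ { refl → toℤ-residue a })

  count-residue : ∀ a → count (λ i → toℤ i ≈? a) ≡ 1
  count-residue a = count-unique (λ i → toℤ i ≈? a) (residue a) (λ i → toℤ≈⇔≡residue a)

  pos-1+*≡* : ∀ a b c d → 1 ℕ.+ a ℕ.* b ≡ c ℕ.* d → 1ℤ + + a * + b ≡ + c * + d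
  pos-1+*≡* a b c d eq = begin
    1ℤ + + a * + b      ≡⟨ cong (_+_ 1ℤ) (ℤ.pos-* a b) ⟨
    1ℤ + + (a ℕ.* b)    ≡⟨ ℤ.pos-+ 1 (a ℕ.* b) ⟨
    + (1 ℕ.+ a ℕ.* b)   ≡⟨ cong +_ eq ⟩
    + (c ℕ.* d)         ≡⟨ ℤ.pos-* c d ⟩
    + c * + d           ∎
    where open ≡.≡-Reasoning

  Bézout⇒inverse : ∀ {r} → Bézout.Identity 1 r ℓ → ∃ λ b → + r * b ≈ 1ℤ
  Bézout⇒inverse {r} (Bézout.+- x y eq) =
    + x , ≡+*ℓ⇒≈ (+ y) (≡.trans (ℤ.*-comm (+ r) (+ x)) (≡.sym (pos-1+*≡* y ℓ x r eq)))
  Bézout⇒inverse {r} (Bézout.-+ x y eq) =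
    - + x , ≡+*ℓ⇒≈ (- + y) (negate (+ r) (+ x) (+ y) (+ ℓ) (pos-1+*≡* x r y ℓ eq))
    where
    negate : ∀ R X Y L → 1ℤ + X * R ≡ Y * L → R * - X ≡ 1ℤ + - Y * L
    negate R X Y L 1+XR≡YL = begin
      R * - X             ≡⟨ solve (R ∷ X ∷ []) ⟩
      1ℤ - (1ℤ + X * R)   ≡⟨ cong (_-_ 1ℤ) 1+XR≡YL ⟩
      1ℤ - Y * L          ≡⟨ solve (Y ∷ L ∷ []) ⟩
      1ℤ + - Y * L        ∎
      where open ≡.≡-Reasoning

module Squares (ℓ : ℕ) .{{_ : NonZero ℓ}} where

  open Congruence ℓ
  open Equivalence

  IsSquare : ℤ → Set
  IsSquare a = ∃ λ x → x * x ≈ a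

  IsSquare-resp : ∀ {a b} → a ≈ b → IsSquare a → IsSquare b
  IsSquare-resp a≈b (x , x²≈a) = x , ≈-trans x²≈a a≈b

  IsSquare-* : ∀ {a b} → IsSquare a → IsSquare b → IsSquare (a * b)
  IsSquare-* (x , x²≈a) (y , y²≈b) = x * y , ≈-trans (≈-reflexive (interchange x y x y)) (*-cong x²≈a y²≈b)

  isSquare? : ∀ a → Dec (IsSquare a)
  isSquare? a = map′
    (λ (i , i²≈a) → toℤ i , i²≈a)
    (λ (x , x²≈a) → residue x , ≈-trans (*-cong (toℤ-residue x) (toℤ-residue x)) x²≈a)
    (Fin.any? (λ i → toℤ i * toℤ i ≈? a))

  sqrtCount : ℤ → ℕ
  sqrtCount a = count (λ t → toℤ t * toℤ t ≈? a)

  sqrtCount-cong : ∀ {a b} → a ≈ b → sqrtCount a ≡ sqrtCount b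
  sqrtCount-cong {a} {b} a≈b = count-cong (λ t → toℤ t * toℤ t ≈? a) (λ t → toℤ t * toℤ t ≈? b)
    (λ t → mk⇔ (λ t²≈a → ≈-trans t²≈a a≈b) (λ t²≈b → ≈-trans t²≈b (≈-sym a≈b)))

  sqrtCount-nonsquare : ∀ {a} → ¬ IsSquare a → sqrtCount a ≡ 0
  sqrtCount-nonsquare ¬□a = count-∅ _ (λ t t²≈a → ¬□a (toℤ t , t²≈a))

  sqrtCount≢0⇒square : ∀ {a} → sqrtCount a ≢ 0 → IsSquare a
  sqrtCount≢0⇒square {a} sqrtCount≢0 = decidable-stable (isSquare? a) (sqrtCount≢0 ∘ sqrtCount-nonsquare)

  any-square⇔IsSquare : ∀ a → Any (λ x → congMod ℓ (+ x * + x) a) (upTo ℓ) ⇔ IsSquare a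
  any-square⇔IsSquare a = mk⇔
    (λ any → let (x , _ , x²≡a) = applyUpTo⁻ id any in + x , to (congMod⇔≈ (+ x * + x) a) x²≡a)
    (λ (x , x²≈a) → applyUpTo⁺ id
      (from (congMod⇔≈ _ a) (≈-trans (*-cong (toℤ-residue x) (toℤ-residue x)) x²≈a))
      (Fin.toℕ<n (residue x)))

  legendre-≈0 : ∀ {a} → a ≈ 0ℤ → legendre a ℓ ≡ 0ℤ
  legendre-≈0 {a} a≈0 with a %ℕ ℓ ℕ.≟ 0
  ... | yes _    = refl
  ... | no a%ℓ≢0 = contradiction (from %ℕ≡0⇔≈0 a≈0) a%ℓ≢0

  legendre-square : ∀ {a} → ¬ a ≈ 0ℤ → IsSquare a → legendre a ℓ ≡ 1ℤ
  legendre-square {a} a≉0 □a with a %ℕ ℓ ℕ.≟ 0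
  ... | yes a%ℓ≡0 = contradiction (to %ℕ≡0⇔≈0 a%ℓ≡0) a≉0
  ... | no _ with any? (λ x → (+ x * + x) %ℕ ℓ ℕ.≟ a %ℕ ℓ) (upTo ℓ)
  ...   | yes _   = refl
  ...   | no ¬any = contradiction (from (any-square⇔IsSquare a) □a) ¬any

  legendre-nonsquare : ∀ {a} → ¬ IsSquare a → legendre a ℓ ≡ -1ℤ
  legendre-nonsquare {a} ¬□a with a %ℕ ℓ ℕ.≟ 0
  ... | yes a%ℓ≡0 = contradiction (0ℤ , ≈-sym (to %ℕ≡0⇔≈0 a%ℓ≡0)) ¬□a
  ... | no _ with any? (λ x → (+ x * + x) %ℕ ℓ ℕ.≟ a %ℕ ℓ) (upTo ℓ)
  ...   | yes any = contradiction (to (any-square⇔IsSquare a) any) ¬□a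
  ...   | no _    = refl

  legendre-cong : ∀ {a b} → a ≈ b → legendre a ℓ ≡ legendre b ℓ
  legendre-cong {a} {b} a≈b = by-cases (a ≈? 0ℤ) (isSquare? a)
    where
    by-cases : Dec (a ≈ 0ℤ) → Dec (IsSquare a) → legendre a ℓ ≡ legendre b ℓ
    by-cases (yes a≈0) _ =
      ≡.trans (legendre-≈0 a≈0) (≡.sym (legendre-≈0 (≈-trans (≈-sym a≈b) a≈0)))
    by-cases (no a≉0) (yes □a) =
      ≡.trans (legendre-square a≉0 □a) (≡.sym (legendre-square (a≉0 ∘ ≈-trans a≈b) (IsSquare-resp a≈b □a)))
    by-cases (no _) (no ¬□a) =
      ≡.trans (legendre-nonsquare ¬□a) (≡.sym (legendre-nonsquare (¬□a ∘ IsSquare-resp (≈-sym a≈b))))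

  legendre≡1⇒square : ∀ {a} → legendre a ℓ ≡ 1ℤ → IsSquare a
  legendre≡1⇒square {a} L≡1 =
    decidable-stable (isSquare? a) (λ ¬□a → case ≡.trans (≡.sym L≡1) (legendre-nonsquare ¬□a) of λ ())

  legendre≡-1⇒nonsquare : ∀ {a} → legendre a ℓ ≡ -1ℤ → ¬ IsSquare a
  legendre≡-1⇒nonsquare {a} L≡-1 □a = case a ≈? 0ℤ of λ where
    (yes a≈0) → case ≡.trans (≡.sym L≡-1) (legendre-≈0 a≈0) of λ ()
    (no a≉0)  → case ≡.trans (≡.sym L≡-1) (legendre-square a≉0 □a) of λ ()

module PrimeModulus (ℓ : ℕ) .{{_ : NonZero ℓ}} (ℓ-prime : Prime ℓ) where

  open import Data.Integer using (_-_)
  open Congruence ℓ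
  open Squares ℓ
  open Equivalence

  *≈0⇒≈0⊎≈0 : ∀ {a b} → a * b ≈ 0ℤ → a ≈ 0ℤ ⊎ b ≈ 0ℤ
  *≈0⇒≈0⊎≈0 {a} {b} ab≈0 =
    Sum.map (from ≈0⇔∣ ∘ ∣ᵤ⇒∣) (from ≈0⇔∣ ∘ ∣ᵤ⇒∣)
      (euclidsLemma ∣ a ∣ ∣ b ∣ ℓ-prime (subst (ℓ ℕ.∣_) (ℤ.abs-* a b) (∣⇒∣ᵤ (to ≈0⇔∣ ab≈0))))

  *-≉0 : ∀ {a b} → ¬ a ≈ 0ℤ → ¬ b ≈ 0ℤ → ¬ a * b ≈ 0ℤ
  *-≉0 a≉0 b≉0 = [ a≉0 , b≉0 ]′ ∘ *≈0⇒≈0⊎≈0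

  *-cancelˡ-≈ : ∀ {a b c} → ¬ a ≈ 0ℤ → a * b ≈ a * c → b ≈ c
  *-cancelˡ-≈ {a} {b} {c} a≉0 ab≈ac =
    [ flip contradiction a≉0 , a-b≈0⇒a≈b ]′ (*≈0⇒≈0⊎≈0 (≈⇒difference≈0 ab≈ac (ab-ac≡a[b-c] a b c)))
    where
    ab-ac≡a[b-c] : ∀ a b c → a * b - a * c ≡ a * (b - c)
    ab-ac≡a[b-c] = solve-∀

  inverse : ∀ {a} → ¬ a ≈ 0ℤ → ∃ λ b → a * b ≈ 1ℤ
  inverse {a} a≉0 = map₂ (≈-trans (*-congʳ _ (≈-%ℕ a))) (Bézout⇒inverse (coprime-Bézout a%ℓ-coprime-ℓ))
    where
    a%ℓ-coprime-ℓ : Coprime (a %ℕ ℓ) ℓ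
    a%ℓ-coprime-ℓ (d∣a%ℓ , d∣ℓ) with prime⇒irreducible ℓ-prime d∣ℓ
    ... | inj₁ d≡1  = d≡1
    ... | inj₂ refl = contradiction (≈-trans (≈-%ℕ a) (from ≈0⇔∣ (∣ᵤ⇒∣ d∣a%ℓ))) a≉0

  square≈0⇒≈0 : ∀ {x} → x * x ≈ 0ℤ → x ≈ 0ℤ
  square≈0⇒≈0 x²≈0 = [ id , id ]′ (*≈0⇒≈0⊎≈0 x²≈0)

  x²≈y²⇒x≈±y : ∀ {x y} → x * x ≈ y * y → x ≈ y ⊎ x ≈ - y
  x²≈y²⇒x≈±y {x} {y} x²≈y² =
    Sum.map a-b≈0⇒a≈b a-b≈0⇒a≈b (*≈0⇒≈0⊎≈0 (≈⇒difference≈0 x²≈y² (difference-of-squares x y)))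
    where
    difference-of-squares : ∀ x y → x * x - y * y ≡ (x - y) * (x - - y)
    difference-of-squares = solve-∀

  IsSquare-cancelʳ : ∀ {a c} → ¬ c ≈ 0ℤ → IsSquare c → IsSquare (a * c) → IsSquare a
  IsSquare-cancelʳ {a} {c} c≉0 (x , x²≈c) (y , y²≈ac) = divide-by-x (inverse x≉0)
    where
    x≉0 : ¬ x ≈ 0ℤ
    x≉0 x≈0 = c≉0 (≈-trans (≈-sym x²≈c) (*-cong x≈0 x≈0))
    divide-by-x : ∃ (λ x⁻¹ → x * x⁻¹ ≈ 1ℤ) → IsSquare a
    divide-by-x (x⁻¹ , xx⁻¹≈1) = y * x⁻¹ , (begin
      (y * x⁻¹) * (y * x⁻¹)       ≡⟨ interchange y x⁻¹ y x⁻¹ ⟩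
      (y * y) * (x⁻¹ * x⁻¹)       ≈⟨ *-congʳ (x⁻¹ * x⁻¹) y²≈ac ⟩
      (a * c) * (x⁻¹ * x⁻¹)       ≈⟨ *-congʳ (x⁻¹ * x⁻¹) (*-congˡ a (≈-sym x²≈c)) ⟩
      (a * (x * x)) * (x⁻¹ * x⁻¹) ≡⟨ ℤ.*-assoc a (x * x) (x⁻¹ * x⁻¹) ⟩
      a * ((x * x) * (x⁻¹ * x⁻¹)) ≡⟨ cong (a *_) (interchange x x x⁻¹ x⁻¹) ⟩
      a * ((x * x⁻¹) * (x * x⁻¹)) ≈⟨ *-congˡ a (*-cong xx⁻¹≈1 xx⁻¹≈1) ⟩
      a * 1ℤ                      ≡⟨ ℤ.*-identityʳ a ⟩
      a                           ∎)
      where open ≈-Reasoning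

  sqrtCount-≈0 : ∀ {a} → a ≈ 0ℤ → sqrtCount a ≡ 1
  sqrtCount-≈0 {a} a≈0 = count-unique _ (residue 0ℤ) (λ t → mk⇔
    (λ t²≈a → to (toℤ≈⇔≡residue 0ℤ) (square≈0⇒≈0 {toℤ t} (≈-trans t²≈a a≈0)))
    (λ t≡r → let t≈0 = from (toℤ≈⇔≡residue 0ℤ) t≡r in ≈-trans (*-cong t≈0 t≈0) (≈-sym a≈0)))

  count-linear : ∀ {a} → ¬ a ≈ 0ℤ → ∀ y → count (λ c → a * toℤ c ≈? y) ≡ 1
  count-linear {a} a≉0 y = divide-by-a (inverse a≉0)
    where
    divide-by-a : ∃ (λ a⁻¹ → a * a⁻¹ ≈ 1ℤ) → count (λ c → a * toℤ c ≈? y) ≡ 1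
    divide-by-a (a⁻¹ , aa⁻¹≈1) = ≡.trans
      (count-cong (λ c → a * toℤ c ≈? y) (λ c → toℤ c ≈? a⁻¹ * y) ac≈y⇔c≈a⁻¹y)
      (count-residue (a⁻¹ * y))
      where
      a[a⁻¹y]≈y : a * (a⁻¹ * y) ≈ y
      a[a⁻¹y]≈y = begin
        a * (a⁻¹ * y)  ≡⟨ ℤ.*-assoc a a⁻¹ y ⟨
        (a * a⁻¹) * y  ≈⟨ *-congʳ y aa⁻¹≈1 ⟩
        1ℤ * y         ≡⟨ ℤ.*-identityˡ y ⟩
        y              ∎
        where open ≈-Reasoning
      ac≈y⇔c≈a⁻¹y : ∀ c → a * toℤ c ≈ y ⇔ toℤ c ≈ a⁻¹ * y
      ac≈y⇔c≈a⁻¹y c = mk⇔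
        (λ ac≈y → *-cancelˡ-≈ a≉0 (≈-trans ac≈y (≈-sym a[a⁻¹y]≈y)))
        (λ c≈a⁻¹y → ≈-trans (*-congˡ a c≈a⁻¹y) a[a⁻¹y]≈y)

  ∑-sqrtCount-scaled : ∀ {a} → ¬ a ≈ 0ℤ → ∑[ c < ℓ ] sqrtCount (a * toℤ c) ≡ ℓ
  ∑-sqrtCount-scaled {a} a≉0 = begin
    ∑[ c < ℓ ] ∑[ t < ℓ ] 𝟙 (toℤ t * toℤ t ≈? a * toℤ c)
      ≡⟨ ∑-comm (λ c t → 𝟙 (toℤ t * toℤ t ≈? a * toℤ c)) ⟩
    ∑[ t < ℓ ] ∑[ c < ℓ ] 𝟙 (toℤ t * toℤ t ≈? a * toℤ c)
      ≡⟨ sum-cong-≗ one-c-per-t ⟩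
    ∑[ t < ℓ ] 1
      ≡⟨ ∑-1 ℓ ⟩
    ℓ
      ∎
    where
    open ≡.≡-Reasoning
    one-c-per-t : ∀ t → ∑[ c < ℓ ] 𝟙 (toℤ t * toℤ t ≈? a * toℤ c) ≡ 1
    one-c-per-t t = ≡.trans
      (count-cong (λ c → toℤ t * toℤ t ≈? a * toℤ c) (λ c → a * toℤ c ≈? toℤ t * toℤ t)
                  (λ c → mk⇔ ≈-sym ≈-sym))
      (count-linear a≉0 (toℤ t * toℤ t))

module OddPrimeModulus (ℓ : ℕ) .{{_ : NonZero ℓ}} (ℓ-prime : Prime ℓ) (2<ℓ : 2 ℕ.< ℓ) where

  open import Data.Integer using (_+_; _-_)
  open Congruence ℓ
  open Squares ℓ
  open PrimeModulus ℓ ℓ-prime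
  open Equivalence

  1≉0 : ¬ 1ℤ ≈ 0ℤ
  1≉0 1≈0 with +-≈-injective (ℕ.<-trans (ℕ.s<s ℕ.z<s) 2<ℓ) (ℕ.>-nonZero⁻¹ ℓ) 1≈0
  ... | ()

  2≉0 : ¬ + 2 ≈ 0ℤ
  2≉0 2≈0 with +-≈-injective 2<ℓ (ℕ.>-nonZero⁻¹ ℓ) 2≈0
  ... | ()

  x≈-x⇒x≈0 : ∀ {x} → x ≈ - x → x ≈ 0ℤ
  x≈-x⇒x≈0 {x} x≈-x = [ flip contradiction 2≉0 , id ]′ (*≈0⇒≈0⊎≈0 (≈⇒difference≈0 x≈-x (x-[-x]≡2x x)))
    where
    x-[-x]≡2x : ∀ x → x - - x ≡ + 2 * x
    x-[-x]≡2x = solve-∀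

  sqrtCount-square : ∀ {a} → ¬ a ≈ 0ℤ → IsSquare a → sqrtCount a ≡ 2
  sqrtCount-square {a} a≉0 (x , x²≈a) = begin
    sqrtCount a
      ≡⟨ count-cong (λ t → toℤ t * toℤ t ≈? a) (λ t → t ≟ x̂ ⊎-dec t ≟ -x̂) t²≈a⇔t≡±x ⟩
    count (λ t → t ≟ x̂ ⊎-dec t ≟ -x̂)
      ≡⟨ count-⊎ (_≟ x̂) (_≟ -x̂) x̂≢-x̂ ⟩
    count (_≟ x̂) ℕ.+ count (_≟ -x̂)
      ≡⟨ cong₂ ℕ._+_ (count-≡ x̂) (count-≡ -x̂) ⟩
    2
      ∎
    where
    open ≡.≡-Reasoning
    x̂ -x̂ : Fin ℓ
    x̂  = residue x
    -x̂ = residue (- x)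
    x̂≢-x̂ : ∀ t → ¬ (t ≡ x̂ × t ≡ -x̂)
    x̂≢-x̂ t (refl , x̂≡-x̂) = a≉0 (≈-trans (≈-sym x²≈a) (*-cong x≈0 x≈0))
      where
      x≈0 : x ≈ 0ℤ
      x≈0 = x≈-x⇒x≈0 (≈-trans (≈-sym (toℤ-residue x)) (from (toℤ≈⇔≡residue (- x)) x̂≡-x̂))
    t²≈a⇔t≡±x : ∀ t → toℤ t * toℤ t ≈ a ⇔ (t ≡ x̂ ⊎ t ≡ -x̂)
    t²≈a⇔t≡±x t = mk⇔
      (λ t²≈a → Sum.map (to (toℤ≈⇔≡residue x)) (to (toℤ≈⇔≡residue (- x)))
                        (x²≈y²⇒x≈±y (≈-trans t²≈a (≈-sym x²≈a))))
      [ (λ t≡x̂  → let t≈x = from (toℤ≈⇔≡residue x) t≡x̂ in ≈-trans (*-cong t≈x t≈x) x²≈a)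
      , (λ t≡-x̂ → let t≈-x = from (toℤ≈⇔≡residue (- x)) t≡-x̂ in
                  ≈-trans (*-cong t≈-x t≈-x) (≈-trans (≈-reflexive (neg-square x)) x²≈a)) ]′
      where
      neg-square : ∀ x → - x * - x ≡ x * x
      neg-square = solve-∀

  sqrtCount≤2 : ∀ a → sqrtCount a ℕ.≤ 2
  sqrtCount≤2 a = by-cases (a ≈? 0ℤ) (isSquare? a)
    where
    by-cases : Dec (a ≈ 0ℤ) → Dec (IsSquare a) → sqrtCount a ℕ.≤ 2
    by-cases (yes a≈0) _        = ℕ.≤-trans (ℕ.≤-reflexive (sqrtCount-≈0 a≈0)) (ℕ.n≤1+n 1)
    by-cases (no a≉0)  (yes □a) = ℕ.≤-reflexive (sqrtCount-square a≉0 □a)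
    by-cases (no _)    (no ¬□a) = ℕ.≤-trans (ℕ.≤-reflexive (sqrtCount-nonsquare ¬□a)) ℕ.z≤n

  ∑-sqrtCount : ∑[ c < ℓ ] sqrtCount (toℤ c) ≡ ℓ
  ∑-sqrtCount = ≡.trans
    (sum-cong-≗ (λ c → sqrtCount-cong (≈-reflexive (≡.sym (ℤ.*-identityˡ (toℤ c))))))
    (∑-sqrtCount-scaled 1≉0)

  nonsquare*nonsquare : ∀ {a b} → ¬ IsSquare a → ¬ IsSquare b → IsSquare (a * b)
  nonsquare*nonsquare {a} {b} ¬□a ¬□b = IsSquare-resp (*-congˡ a (toℤ-residue b)) □ab̂
    where
    a≉0 : ¬ a ≈ 0ℤ
    a≉0 a≈0 = ¬□a (0ℤ , ≈-sym a≈0)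
    roots : Fin ℓ → ℕ
    roots c = sqrtCount (toℤ c) ℕ.+ sqrtCount (a * toℤ c)
    roots≤2 : ∀ c → roots c ℕ.≤ 2
    roots≤2 c = by-cases (toℤ c ≈? 0ℤ) (isSquare? (toℤ c))
      where
      ac≈0 : toℤ c ≈ 0ℤ → a * toℤ c ≈ 0ℤ
      ac≈0 c≈0 = ≈-trans (*-congˡ a c≈0) (≈-reflexive (ℤ.*-zeroʳ a))
      by-cases : Dec (toℤ c ≈ 0ℤ) → Dec (IsSquare (toℤ c)) → roots c ℕ.≤ 2
      by-cases (yes c≈0) _ =
        ℕ.≤-reflexive (cong₂ ℕ._+_ (sqrtCount-≈0 c≈0) (sqrtCount-≈0 (ac≈0 c≈0)))
      by-cases (no c≉0)  (yes □c) = ℕ.≤-reflexive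
        (cong₂ ℕ._+_ (sqrtCount-square c≉0 □c) (sqrtCount-nonsquare (¬□a ∘ IsSquare-cancelʳ c≉0 □c)))
      by-cases (no _)    (no ¬□c) = ℕ.≤-trans
        (ℕ.≤-reflexive (cong (ℕ._+ sqrtCount (a * toℤ c)) (sqrtCount-nonsquare ¬□c)))
        (sqrtCount≤2 (a * toℤ c))
    ∑roots≡∑2 : ∑[ c < ℓ ] roots c ≡ ∑[ c < ℓ ] 2
    ∑roots≡∑2 = begin
      ∑[ c < ℓ ] roots c
        ≡⟨ ∑-distrib-+ (sqrtCount ∘ toℤ) (λ c → sqrtCount (a * toℤ c)) ⟩
      ∑[ c < ℓ ] sqrtCount (toℤ c) ℕ.+ ∑[ c < ℓ ] sqrtCount (a * toℤ c)
        ≡⟨ cong₂ ℕ._+_ ∑-sqrtCount (∑-sqrtCount-scaled a≉0) ⟩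
      ℓ ℕ.+ ℓ
        ≡⟨ cong₂ ℕ._+_ (∑-1 ℓ) (∑-1 ℓ) ⟨
      ∑[ c < ℓ ] 1 ℕ.+ ∑[ c < ℓ ] 1
        ≡⟨ ∑-distrib-+ {ℓ} (λ _ → 1) (λ _ → 1) ⟨
      ∑[ c < ℓ ] 2
        ∎
      where open ≡.≡-Reasoning
    b̂ = residue b
    sqrtCount[ab̂]≡2 : sqrtCount (a * toℤ b̂) ≡ 2
    sqrtCount[ab̂]≡2 = begin
      sqrtCount (a * toℤ b̂)
        ≡⟨ cong (ℕ._+ sqrtCount (a * toℤ b̂)) (sqrtCount-nonsquare ¬□b̂) ⟨
      sqrtCount (toℤ b̂) ℕ.+ sqrtCount (a * toℤ b̂)
        ≡⟨ pointwise-≤∧∑-≡⇒≡ roots≤2 ∑roots≡∑2 b̂ ⟩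
      2
        ∎
      where
      open ≡.≡-Reasoning
      ¬□b̂ : ¬ IsSquare (toℤ b̂)
      ¬□b̂ = ¬□b ∘ IsSquare-resp (toℤ-residue b)
    □ab̂ : IsSquare (a * toℤ b̂)
    □ab̂ = sqrtCount≢0⇒square (ℕ.1+n≢0 ∘ ≡.trans (≡.sym sqrtCount[ab̂]≡2))

  legendre-* : ∀ {a b} → ¬ a ≈ 0ℤ → ¬ b ≈ 0ℤ → legendre (a * b) ℓ ≡ legendre a ℓ * legendre b ℓ
  legendre-* {a} {b} a≉0 b≉0 = by-cases (isSquare? a) (isSquare? b)
    where
    ab≉0 = *-≉0 a≉0 b≉0
    by-cases : Dec (IsSquare a) → Dec (IsSquare b) → legendre (a * b) ℓ ≡ legendre a ℓ * legendre b ℓ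
    by-cases (yes □a) (yes □b) = ≡.trans
      (legendre-square ab≉0 (IsSquare-* □a □b))
      (≡.sym (cong₂ _*_ (legendre-square a≉0 □a) (legendre-square b≉0 □b)))
    by-cases (yes □a) (no ¬□b) = ≡.trans
      (legendre-nonsquare (¬□b ∘ IsSquare-cancelʳ a≉0 □a ∘ IsSquare-resp (≈-reflexive (ℤ.*-comm a b))))
      (≡.sym (cong₂ _*_ (legendre-square a≉0 □a) (legendre-nonsquare ¬□b)))
    by-cases (no ¬□a) (yes □b) = ≡.trans
      (legendre-nonsquare (¬□a ∘ IsSquare-cancelʳ b≉0 □b))
      (≡.sym (cong₂ _*_ (legendre-nonsquare ¬□a) (legendre-square b≉0 □b)))
    by-cases (no ¬□a) (no ¬□b) = ≡.trans
      (legendre-square ab≉0 (nonsquare*nonsquare ¬□a ¬□b))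
      (≡.sym (cong₂ _*_ (legendre-nonsquare ¬□a) (legendre-nonsquare ¬□b)))

  legendre≡±1 : ∀ {a} → ¬ a ≈ 0ℤ → legendre a ℓ ≡ 1ℤ ⊎ legendre a ℓ ≡ -1ℤ
  legendre≡±1 {a} a≉0 = case isSquare? a of λ where
    (yes □a) → inj₁ (legendre-square a≉0 □a)
    (no ¬□a) → inj₂ (legendre-nonsquare ¬□a)

  sqrtCount-legendre : ∀ {a} → ¬ a ≈ 0ℤ → + sqrtCount a ≡ 1ℤ + legendre a ℓ
  sqrtCount-legendre {a} a≉0 = case isSquare? a of λ where
    (yes □a) → ≡.trans (cong +_ (sqrtCount-square a≉0 □a)) (≡.sym (cong (_+_ 1ℤ) (legendre-square a≉0 □a)))
    (no ¬□a) → ≡.trans (cong +_ (sqrtCount-nonsquare ¬□a)) (≡.sym (cong (_+_ 1ℤ) (legendre-nonsquare ¬□a)))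

2+x+y≡2 : ∀ {x y} → x ≡ 1ℤ ⊎ x ≡ -1ℤ → y ≡ 1ℤ ⊎ y ≡ -1ℤ → x * y ≡ -1ℤ → + 2 ℤ.+ x ℤ.+ y ≡ + 2
2+x+y≡2 (inj₁ refl) (inj₁ refl) ()
2+x+y≡2 (inj₁ refl) (inj₂ refl) _ = refl
2+x+y≡2 (inj₂ refl) (inj₁ refl) _ = refl
2+x+y≡2 (inj₂ refl) (inj₂ refl) ()

2+x+y≡0∨4 : ∀ {x y} → x ≡ 1ℤ ⊎ x ≡ -1ℤ → y ≡ 1ℤ ⊎ y ≡ -1ℤ → x * y ≡ 1ℤ →
            + 2 ℤ.+ x ℤ.+ y ≡ 0ℤ ⊎ + 2 ℤ.+ x ℤ.+ y ≡ + 4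
2+x+y≡0∨4 (inj₁ refl) (inj₁ refl) _ = inj₂ refl
2+x+y≡0∨4 (inj₁ refl) (inj₂ refl) ()
2+x+y≡0∨4 (inj₂ refl) (inj₁ refl) ()
2+x+y≡0∨4 (inj₂ refl) (inj₂ refl) _ = inj₁ refl

module Quartic (ℓ : ℕ) .{{_ : NonZero ℓ}} (ℓ-prime : Prime ℓ) (ℓ≥5 : ℓ ℕ.≥ 5) where

  open import Data.Integer using (_+_; _-_)

  2<ℓ : 2 ℕ.< ℓ
  2<ℓ = ℕ.<-≤-trans (ℕ.s≤s (ℕ.s≤s (ℕ.s≤s ℕ.z≤n))) ℓ≥5

  open Congruence ℓ
  open Squares ℓ
  open PrimeModulus ℓ ℓ-prime
  open OddPrimeModulus ℓ ℓ-prime 2<ℓ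
  open Equivalence

  3≉0 : ¬ + 3 ≈ 0ℤ
  3≉0 3≈0 with +-≈-injective (ℕ.<-≤-trans (ℕ.s≤s (ℕ.s≤s (ℕ.s≤s (ℕ.s≤s ℕ.z≤n)))) ℓ≥5) (ℕ.>-nonZero⁻¹ ℓ) 3≈0
  ... | ()

  4≉0 : ¬ + 4 ≈ 0ℤ
  4≉0 = *-≉0 {+ 2} {+ 2} 2≉0 2≉0

  432≉0 : ¬ + 432 ≈ 0ℤ
  432≉0 = *-≉0 {+ 16} {+ 27} (*-≉0 {+ 4} {+ 4} 4≉0 4≉0) (*-≉0 {+ 3} {+ 9} 3≉0 (*-≉0 {+ 3} {+ 3} 3≉0 3≉0))

  -432≉0 : ¬ - + 432 ≈ 0ℤ
  -432≉0 = 432≉0 ∘ -‿cong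

  quad : ℤ → ℤ
  quad u = u * u + + 36 * u + + 432

  quad-cong : ∀ {a b} → a ≈ b → quad a ≈ quad b
  quad-cong a≈b = +-congʳ (+ 432) (+-cong (*-cong a≈b a≈b) (*-congˡ (+ 36) a≈b))

  quad-root≉0 : ∀ {u} → quad u ≈ 0ℤ → ¬ u ≈ 0ℤ
  quad-root≉0 qu≈0 u≈0 = 432≉0 (≈-trans (≈-sym (quad-cong u≈0)) qu≈0)

  rootCount≡count : rootCount ℓ ≡ count (λ t → p (toℤ t) ≈? 0ℤ)
  rootCount≡count = ≡.trans (length-filter-applyUpTo (λ t → p (+ t) %ℕ ℓ ℕ.≟ 0) id ℓ)
    (count-cong (λ t → p (toℤ t) %ℕ ℓ ℕ.≟ 0) (λ t → p (toℤ t) ≈? 0ℤ) (λ t → %ℕ≡0⇔≈0))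

  record DistinctRoots : Set where
    constructor distinctRoots
    field
      {u₁ u₂} : ℤ
      q₁≈0    : quad u₁ ≈ 0ℤ
      q₂≈0    : quad u₂ ≈ 0ℤ
      u₁≉u₂   : ¬ u₁ ≈ u₂

  module Roots (roots : DistinctRoots) where

    open DistinctRoots roots

    u₁≉0 : ¬ u₁ ≈ 0ℤ
    u₁≉0 = quad-root≉0 {u₁} q₁≈0

    u₂≉0 : ¬ u₂ ≈ 0ℤ
    u₂≉0 = quad-root≉0 {u₂} q₂≈0

    u₁+u₂+36≈0 : u₁ + u₂ + + 36 ≈ 0ℤ
    u₁+u₂+36≈0 = [ flip contradiction (u₁≉u₂ ∘ a-b≈0⇒a≈b) , id ]′
      (*≈0⇒≈0⊎≈0 (≈⇒difference≈0 (≈-trans q₁≈0 (≈-sym q₂≈0)) (quad-difference u₁ u₂)))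
      where
      quad-difference : ∀ u₁ u₂ → (u₁ * u₁ + + 36 * u₁ + + 432) - (u₂ * u₂ + + 36 * u₂ + + 432)
                                  ≡ (u₁ - u₂) * (u₁ + u₂ + + 36)
      quad-difference = solve-∀

    u₁u₂≈432 : u₁ * u₂ ≈ + 432
    u₁u₂≈432 = begin
      u₁ * u₂
        ≡⟨ product-identity u₁ u₂ ⟩
      u₁ * (u₁ + u₂ + + 36) - quad u₁ + + 432
        ≈⟨ +-congʳ (+ 432) (+-cong (*-congˡ u₁ u₁+u₂+36≈0) (-‿cong q₁≈0)) ⟩
      u₁ * 0ℤ - 0ℤ + + 432
        ≡⟨ cong (λ z → z - 0ℤ + + 432) (ℤ.*-zeroʳ u₁) ⟩
      + 432
        ∎
      where
      open ≈-Reasoning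
      product-identity : ∀ u₁ u₂ → u₁ * u₂
                                   ≡ u₁ * (u₁ + u₂ + + 36) - (u₁ * u₁ + + 36 * u₁ + + 432) + + 432
      product-identity = solve-∀

    p-factors : ∀ t → p t ≈ (t * t - u₁) * (t * t - u₂)
    p-factors t = begin
      p t
        ≡⟨ factor-identity t u₁ u₂ ⟩
      (t * t - u₁) * (t * t - u₂) + (u₁ + u₂ + + 36) * (t * t) + (+ 432 - u₁ * u₂)
        ≈⟨ +-cong (+-congˡ ((t * t - u₁) * (t * t - u₂)) (*-congʳ (t * t) u₁+u₂+36≈0))
                  (+-congˡ (+ 432) (-‿cong u₁u₂≈432)) ⟩
      (t * t - u₁) * (t * t - u₂) + 0ℤ * (t * t) + (+ 432 - + 432)
        ≡⟨ ℤ.+-identityʳ _ ⟩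
      (t * t - u₁) * (t * t - u₂) + 0ℤ
        ≡⟨ ℤ.+-identityʳ _ ⟩
      (t * t - u₁) * (t * t - u₂)
        ∎
      where
      open ≈-Reasoning
      factor-identity : ∀ t u₁ u₂ → t * t * t * t + + 36 * t * t + + 432
                        ≡ (t * t - u₁) * (t * t - u₂) + (u₁ + u₂ + + 36) * (t * t) + (+ 432 - u₁ * u₂)
      factor-identity = solve-∀

    p≈0⇔t²≈u₁⊎t²≈u₂ : ∀ t → p t ≈ 0ℤ ⇔ (t * t ≈ u₁ ⊎ t * t ≈ u₂)
    p≈0⇔t²≈u₁⊎t²≈u₂ t = mk⇔
      (λ pt≈0 → Sum.map a-b≈0⇒a≈b a-b≈0⇒a≈b (*≈0⇒≈0⊎≈0 (≈-trans (≈-sym (p-factors t)) pt≈0)))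
      [ (λ t²≈u₁ → ≈-trans (p-factors t) (≈-trans (*-congʳ (t * t - u₂) (≈⇒difference≈0 t²≈u₁ refl))
                                                  (≈-reflexive (ℤ.*-zeroˡ (t * t - u₂)))))
      , (λ t²≈u₂ → ≈-trans (p-factors t) (≈-trans (*-congˡ (t * t - u₁) (≈⇒difference≈0 t²≈u₂ refl))
                                                  (≈-reflexive (ℤ.*-zeroʳ (t * t - u₁))))) ]′

    rootCount≡sqrtCount+sqrtCount : rootCount ℓ ≡ sqrtCount u₁ ℕ.+ sqrtCount u₂
    rootCount≡sqrtCount+sqrtCount = begin
      rootCount ℓ
        ≡⟨ rootCount≡count ⟩
      count (λ t → p (toℤ t) ≈? 0ℤ)
        ≡⟨ count-cong (λ t → p (toℤ t) ≈? 0ℤ) (λ t → t² t ≈? u₁ ⊎-dec t² t ≈? u₂) (p≈0⇔t²≈u₁⊎t²≈u₂ ∘ toℤ) ⟩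
      count (λ t → t² t ≈? u₁ ⊎-dec t² t ≈? u₂)
        ≡⟨ count-⊎ (λ t → t² t ≈? u₁) (λ t → t² t ≈? u₂)
                   (λ t (t²≈u₁ , t²≈u₂) → u₁≉u₂ (≈-trans (≈-sym t²≈u₁) t²≈u₂)) ⟩
      sqrtCount u₁ ℕ.+ sqrtCount u₂
        ∎
      where
      open ≡.≡-Reasoning
      t² : Fin ℓ → ℤ
      t² t = toℤ t * toℤ t

    rootCount-legendre : + rootCount ℓ ≡ + 2 + legendre u₁ ℓ + legendre u₂ ℓ
    rootCount-legendre = begin
      + rootCount ℓ                               ≡⟨ cong +_ rootCount≡sqrtCount+sqrtCount ⟩
      + (sqrtCount u₁ ℕ.+ sqrtCount u₂)           ≡⟨ ℤ.pos-+ (sqrtCount u₁) (sqrtCount u₂) ⟩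
      + sqrtCount u₁ + + sqrtCount u₂             ≡⟨ cong₂ _+_ (sqrtCount-legendre u₁≉0)
                                                               (sqrtCount-legendre u₂≉0) ⟩
      (1ℤ + legendre u₁ ℓ) + (1ℤ + legendre u₂ ℓ) ≡⟨ regroup (legendre u₁ ℓ) (legendre u₂ ℓ) ⟩
      + 2 + legendre u₁ ℓ + legendre u₂ ℓ         ∎
      where
      open ≡.≡-Reasoning
      regroup : ∀ x y → (1ℤ + x) + (1ℤ + y) ≡ + 2 + x + y
      regroup = solve-∀

    legendre-u₁≡±1 : legendre u₁ ℓ ≡ 1ℤ ⊎ legendre u₁ ℓ ≡ -1ℤ
    legendre-u₁≡±1 = legendre≡±1 u₁≉0

    legendre-u₂≡±1 : legendre u₂ ℓ ≡ 1ℤ ⊎ legendre u₂ ℓ ≡ -1ℤ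
    legendre-u₂≡±1 = legendre≡±1 u₂≉0

    legendre-u₁*legendre-u₂ : legendre u₁ ℓ * legendre u₂ ℓ ≡ legendre (+ 432) ℓ
    legendre-u₁*legendre-u₂ =
      ≡.trans (≡.sym (legendre-* {u₁} {u₂} u₁≉0 u₂≉0)) (legendre-cong u₁u₂≈432)

  rootCount-Δ-nonsquare : ¬ IsSquare (- + 432) → rootCount ℓ ≡ 0
  rootCount-Δ-nonsquare ¬□Δ =
    ≡.trans rootCount≡count (count-∅ (λ t → p (toℤ t) ≈? 0ℤ) (λ t → ¬□Δ ∘ √Δ (toℤ t)))
    where
    √Δ : ∀ t → p t ≈ 0ℤ → IsSquare (- + 432)
    √Δ t pt≈0 = + 2 * (t * t) + + 36 , (begin
      (+ 2 * (t * t) + + 36) * (+ 2 * (t * t) + + 36) ≡⟨ completed-square t ⟩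
      + 4 * p t - + 432                              ≈⟨ +-congʳ (- + 432) (*-congˡ (+ 4) pt≈0) ⟩
      - + 432                                        ∎)
      where
      open ≈-Reasoning
      completed-square : ∀ t → (+ 2 * (t * t) + + 36) * (+ 2 * (t * t) + + 36)
                               ≡ + 4 * (t * t * t * t + + 36 * t * t + + 432) - + 432
      completed-square = solve-∀

  √Δ⇒root : ∀ {σ h} → σ * σ ≈ - + 432 → + 2 * h ≈ - + 36 + σ → quad h ≈ 0ℤ
  √Δ⇒root {σ} {h} σ²≈Δ 2h≈-36+σ = *-cancelˡ-≈ 4≉0 (begin
    + 4 * quad h                                ≡⟨ completed-square h ⟩
    (+ 2 * h + + 36) * (+ 2 * h + + 36) + + 432 ≈⟨ +-congʳ (+ 432) (*-cong 2h+36≈σ 2h+36≈σ) ⟩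
    σ * σ + + 432                               ≈⟨ +-congʳ (+ 432) σ²≈Δ ⟩
    + 4 * 0ℤ                                    ∎)
    where
    open ≈-Reasoning
    completed-square : ∀ h → + 4 * (h * h + + 36 * h + + 432) ≡ (+ 2 * h + + 36) * (+ 2 * h + + 36) + + 432
    completed-square = solve-∀
    cancel-36 : ∀ σ → - + 36 + σ + + 36 ≡ σ
    cancel-36 = solve-∀
    2h+36≈σ : + 2 * h + + 36 ≈ σ
    2h+36≈σ = ≈-trans (+-congʳ (+ 36) 2h≈-36+σ) (≈-reflexive (cancel-36 σ))

  √Δ⇒distinctRoots : ∀ {s h₁ h₂} → s * s ≈ - + 432 → + 2 * h₁ ≈ - + 36 + s → + 2 * h₂ ≈ - + 36 - s →
                     DistinctRoots
  √Δ⇒distinctRoots {s} {h₁} {h₂} s²≈Δ 2h₁≈-36+s 2h₂≈-36-s = distinctRoots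
    (√Δ⇒root {s} s²≈Δ 2h₁≈-36+s)
    (√Δ⇒root { - s} (≈-trans (≈-reflexive (neg-square s)) s²≈Δ) 2h₂≈-36-s)
    (λ h₁≈h₂ → -432≉0 (≈-trans (≈-sym s²≈Δ) (*-cong (s≈0 h₁≈h₂) (s≈0 h₁≈h₂))))
    where
    neg-square : ∀ x → - x * - x ≡ x * x
    neg-square = solve-∀
    shift : ∀ x → x ≡ + 36 + (- + 36 + x)
    shift = solve-∀
    s≈0 : h₁ ≈ h₂ → s ≈ 0ℤ
    s≈0 h₁≈h₂ = x≈-x⇒x≈0 (begin
      s                    ≡⟨ shift s ⟩
      + 36 + (- + 36 + s)  ≈⟨ +-congˡ (+ 36) -36+s≈-36-s ⟩
      + 36 + (- + 36 - s)  ≡⟨ shift (- s) ⟨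
      - s                  ∎)
      where
      open ≈-Reasoning
      -36+s≈-36-s : - + 36 + s ≈ - + 36 - s
      -36+s≈-36-s = ≈-trans (≈-sym 2h₁≈-36+s) (≈-trans (*-congˡ (+ 2) h₁≈h₂) 2h₂≈-36-s)

  Δ-square⇒distinctRoots : IsSquare (- + 432) → DistinctRoots
  Δ-square⇒distinctRoots (s , s²≈Δ) = halve (inverse 2≉0)
    where
    halve : ∃ (λ i → + 2 * i ≈ 1ℤ) → DistinctRoots
    halve (i , 2i≈1) = √Δ⇒distinctRoots {s} s²≈Δ (2[ix]≈x (- + 36 + s)) (2[ix]≈x (- + 36 - s))
      where
      2[ix]≈x : ∀ x → + 2 * (i * x) ≈ x
      2[ix]≈x x = begin
        + 2 * (i * x)  ≡⟨ ℤ.*-assoc (+ 2) i x ⟨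
        (+ 2 * i) * x  ≈⟨ *-congʳ x 2i≈1 ⟩
        1ℤ * x         ≡⟨ ℤ.*-identityˡ x ⟩
        x              ∎
        where open ≈-Reasoning

lemma4p3 : (ℓ : ℕ) → .{{_ : ℕ.NonZero ℓ}} → Prime ℓ → ℓ ≥ 5 →
  (legendre (- + 432) ℓ ≡ -[1+ 0 ] → rootCount ℓ ≡ 0)
  × (legendre (- + 432) ℓ ≡ + 1 →
      (∀ (u₁ u₂ : ℤ) →
        congMod ℓ (u₁ * u₁ ℤ.+ + 36 * u₁ ℤ.+ + 432) (+ 0) →
        congMod ℓ (u₂ * u₂ ℤ.+ + 36 * u₂ ℤ.+ + 432) (+ 0) →
        ¬ (congMod ℓ u₁ u₂) →
        + rootCount ℓ ≡ + 2 ℤ.+ legendre u₁ ℓ ℤ.+ legendre u₂ ℓ)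
      × (legendre (+ 432) ℓ ≡ -[1+ 0 ] → rootCount ℓ ≡ 2)
      × (legendre (+ 432) ℓ ≡ + 1 → rootCount ℓ ≡ 0 ⊎ rootCount ℓ ≡ 4)
      × (∀ (s h₁ h₂ : ℤ) →
        congMod ℓ (s * s) (- + 432) →
        congMod ℓ (+ 2 * h₁) (- + 36 ℤ.+ s) →
        congMod ℓ (+ 2 * h₂) (- + 36 ℤ.- s) →
        + rootCount ℓ ≡ + 2 ℤ.+ legendre h₁ ℓ ℤ.+ legendre h₂ ℓ))
lemma4p3 ℓ ℓ-prime ℓ≥5 =
    rootCount-Δ-nonsquare ∘ legendre≡-1⇒nonsquare
  , λ legendre-Δ≡1 → let open Roots (Δ-square⇒distinctRoots (legendre≡1⇒square legendre-Δ≡1)) in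
      (λ u₁ u₂ q₁≡0 q₂≡0 u₁≢u₂ → Roots.rootCount-legendre (distinctRoots
         (to (congMod⇔≈ (quad u₁) 0ℤ) q₁≡0)
         (to (congMod⇔≈ (quad u₂) 0ℤ) q₂≡0)
         (u₁≢u₂ ∘ from (congMod⇔≈ u₁ u₂))))
    , (λ legendre-432≡-1 → ℤ.+-injective (≡.trans rootCount-legendre
         (2+x+y≡2 legendre-u₁≡±1 legendre-u₂≡±1 (≡.trans legendre-u₁*legendre-u₂ legendre-432≡-1))))
    , (λ legendre-432≡1 → Sum.map (ℤ.+-injective ∘ ≡.trans rootCount-legendre)
                                  (ℤ.+-injective ∘ ≡.trans rootCount-legendre)
         (2+x+y≡0∨4 legendre-u₁≡±1 legendre-u₂≡±1 (≡.trans legendre-u₁*legendre-u₂ legendre-432≡1)))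
    , (λ s h₁ h₂ s²≡Δ 2h₁≡-36+s 2h₂≡-36-s → Roots.rootCount-legendre (√Δ⇒distinctRoots {s}
         (to (congMod⇔≈ (s * s) (- + 432)) s²≡Δ)
         (to (congMod⇔≈ (+ 2 * h₁) (- + 36 ℤ.+ s)) 2h₁≡-36+s)
         (to (congMod⇔≈ (+ 2 * h₂) (- + 36 ℤ.- s)) 2h₂≡-36-s)))
  where
  open Congruence ℓ
  open Squares ℓ
  open Quartic ℓ ℓ-prime ℓ≥5
  open Equivalence
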